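{- Let $p$ be a prime and $s$ a positive integer. If a system $L_1,\dots,L_m$ of linear forms (in $d$ variables, with coefficients in $\mathbb{F}_p$) is degree-$s$ independent, then it is degree-$t$ independent for all integers $t$ with $s\leq t<p$.
   Context: A linear form in $d$ variables is $L(x)=c_1x_1+\dots+c_dx_d$ with $c_j\in\mathbb{F}_p$, viewed as a function $\mathbb{F}_p^d\to\mathbb{F}_p$. The system is degree-$t$ independent if the functions $L_1^t,\dots,L_m^t:\mathbb{F}_p^d\to\mathbb{F}_p$ are linearly independent over $\mathbb{F}_p$. -}

module Defs where

open import Data.Nat using (ℕ; zero; suc; _+_; _*_; _^_; NonZero)
open import Data.Nat.DivMod using (_%_)
open import Data.Fin using (Fin; toℕ)
open import Data.Nat.Primality using (Prime)
open import Relation.Binary.PropositionalEquality using (_≡_)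

-- The prime field F_p is represented by Fin p (residues 0..p-1);
-- arithmetic is carried out in ℕ and reduced modulo p.

Σ : ∀ {n} → (Fin n → ℕ) → ℕ
Σ {zero}  f = 0
Σ {suc n} f = f Fin.zero + Σ (λ i → f (Fin.suc i))

LinearForm : ℕ → ℕ → Set
LinearForm p d = Fin d → Fin p

-- Evaluation L(x) = c_1 x_1 + ... + c_d x_d, as an element of ℕ (mod p taken later).
evalForm : ∀ {p d} → LinearForm p d → (Fin d → Fin p) → ℕ
evalForm c x = Σ (λ j → toℕ (c j) * toℕ (x j))

DegreeIndependent : (p : ℕ) .{{_ : NonZero p}} (d m t : ℕ) → (Fin m → LinearForm p d) → Set
DegreeIndependent p d m t L =
  (a : Fin m → Fin p) →
  ((x : Fin d → Fin p) → Σ (λ i → toℕ (a i) * evalForm (L i) x ^ t) % p ≡ 0) →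
  (i : Fin m) → toℕ (a i) ≡ 0

-- By induction on t it suffices to pass from degree t to degree t+1 when
-- t+1 < p.  Suppose Σ a_j L_j^{t+1} vanishes on F_p^d and fix x, y.  Since
-- L_j(x + n y) ≡ L_j(x) + n L_j(y), the integer polynomial
--   f(X) = Σ a_j (L_j(x) + X L_j(y))^{t+1}
-- of degree t+1 vanishes modulo p at X = 0, 1, ..., t+1.  These t+2 ≤ p
-- points are pairwise incongruent, so every coefficient of f is divisible by
-- p; in particular the linear one, (t+1) Σ a_j L_j(y) L_j(x)^t.  As t+1 < p,
-- the coefficients a_j L_j(y) give a degree-t relation, hence p ∣ a_j L_j(y)
-- for every y.  Degree-s independence with s ≥ 1 forbids L_j from vanishing
-- identically, so p ∣ a_j, i.e. a_j = 0.

module Submission where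

open import Defs
open import Data.Empty using (⊥-elim)
open import Data.Fin using (Fin; zero; suc; toℕ; fromℕ<; _≟_)
open import Data.Fin.Properties using (toℕ-fromℕ<; toℕ<n; toℕ-injective; suc-injective; 0≢1+n)
open import Data.Nat as Nat using (ℕ; zero; suc; _≤_; _<_; s≤s; NonZero; >-nonZero⁻¹; nonTrivial⇒n>1)
import Data.Nat.Properties as ℕP
open import Data.Nat.DivMod using (_%_; m%n<n; %-distribˡ-+; %-distribˡ-*; m%n%n≡m%n)
open import Data.Nat.Divisibility using (_∣_; _∣?_; ∣⇒≤; _∣0; m%n≡0⇒n∣m; n∣m⇒m%n≡0; ∣m∣n⇒∣m+n; ∣m⇒∣m*n; ∣n⇒∣m*n)
open import Data.Nat.Primality using (Prime; euclidsLemma; prime⇒nonTrivial)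
open import Data.Integer as Int using (ℤ; +_; 0ℤ; 1ℤ; _⊖_)
import Data.Integer.Properties as ℤP
import Data.Integer.Divisibility.Signed as ℤ∣
open ℤ∣ using () renaming (_∣_ to _∣ℤ_)
open import Algebra.Properties.Semiring.Sum ℤP.+-*-semiring using (sum-cong-≗; *-distribˡ-sum) renaming (sum to Σℤ)
open import Data.Vec using (Vec; []; _∷_; lookup; zipWith; map; replicate)
open import Data.Vec.Properties using (lookup-zipWith; lookup-map; lookup-replicate)
open import Data.Sum using (inj₁; inj₂; [_,_]′)
open import Function using (_∘_; id)
open import Relation.Nullary using (¬_; yes; no; contradiction)
open import Relation.Binary.PropositionalEquality using (_≡_; refl; sym; trans; cong; cong₂; subst; module ≡-Reasoning)
open ≡-Reasoning

-- Integer polynomials as coefficient vectors, and the root-counting lemma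
-- modulo a prime.
module Polynomial where

  open Int using (_+_; _*_; _-_; _^_)
  open import Data.Integer.Tactic.RingSolver using (solve-∀)

  -- A polynomial with n coefficients, constant term first.
  Poly : ℕ → Set
  Poly = Vec ℤ

  eval : ∀ {n} → Poly n → ℤ → ℤ
  eval []       k = 0ℤ
  eval (c ∷ cs) k = c + k * eval cs k

  eval-+ : ∀ {n} (f g : Poly n) k → eval (zipWith _+_ f g) k ≡ eval f k + eval g k
  eval-+ []      []      k = refl
  eval-+ (a ∷ f) (b ∷ g) k = begin
    a + b + k * eval (zipWith _+_ f g) k  ≡⟨ cong (λ e → a + b + k * e) (eval-+ f g k) ⟩
    a + b + k * (eval f k + eval g k)     ≡⟨ rearrange a b k (eval f k) (eval g k) ⟩
    a + k * eval f k + (b + k * eval g k) ∎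
    where
    rearrange : ∀ a b k x y → a + b + k * (x + y) ≡ a + k * x + (b + k * y)
    rearrange = solve-∀

  eval-scale : ∀ {n} a (f : Poly n) k → eval (map (a *_) f) k ≡ a * eval f k
  eval-scale a []      k = sym (ℤP.*-zeroʳ a)
  eval-scale a (c ∷ f) k = begin
    a * c + k * eval (map (a *_) f) k  ≡⟨ cong (λ e → a * c + k * e) (eval-scale a f k) ⟩
    a * c + k * (a * eval f k)         ≡⟨ rearrange a c k (eval f k) ⟩
    a * (c + k * eval f k)             ∎
    where
    rearrange : ∀ a c k x → a * c + k * (a * x) ≡ a * (c + k * x)
    rearrange = solve-∀

  eval-0 : ∀ n k → eval (replicate n 0ℤ) k ≡ 0ℤ
  eval-0 zero    k = refl
  eval-0 (suc n) k = trans (ℤP.+-identityˡ _) (trans (cong (k *_) (eval-0 n k)) (ℤP.*-zeroʳ k))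

  combination : ∀ {m n} → (Fin m → ℤ) → (Fin m → Poly n) → Poly n
  combination {zero}  a f = replicate _ 0ℤ
  combination {suc m} a f = zipWith _+_ (map (a zero *_) (f zero)) (combination (a ∘ suc) (f ∘ suc))

  eval-combination : ∀ {m n} (a : Fin m → ℤ) (f : Fin m → Poly n) k →
                     eval (combination a f) k ≡ Σℤ (λ i → a i * eval (f i) k)
  eval-combination {zero}  {n} a f k = eval-0 n k
  eval-combination {suc m}     a f k = begin
    eval (zipWith _+_ (map (a zero *_) (f zero)) (combination (a ∘ suc) (f ∘ suc))) k
      ≡⟨ eval-+ (map (a zero *_) (f zero)) (combination (a ∘ suc) (f ∘ suc)) k ⟩
    eval (map (a zero *_) (f zero)) k + eval (combination (a ∘ suc) (f ∘ suc)) k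
      ≡⟨ cong₂ _+_ (eval-scale (a zero) (f zero) k) (eval-combination (a ∘ suc) (f ∘ suc) k) ⟩
    Σℤ (λ i → a i * eval (f i) k) ∎

  coefficient-combination : ∀ {m n} (a : Fin m → ℤ) (f : Fin m → Poly n) j →
                            lookup (combination a f) j ≡ Σℤ (λ i → a i * lookup (f i) j)
  coefficient-combination {zero}  a f j = lookup-replicate j 0ℤ
  coefficient-combination {suc m} a f j =
    trans (lookup-zipWith _+_ j (map (a zero *_) (f zero)) (combination (a ∘ suc) (f ∘ suc)))
          (cong₂ _+_ (lookup-map j (a zero *_) (f zero)) (coefficient-combination (a ∘ suc) (f ∘ suc) j))

  addConstant : ∀ {n} → ℤ → Poly (suc n) → Poly (suc n)
  addConstant a (c ∷ cs) = a + c ∷ cs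

  mulLinear : ∀ {n} → ℤ → ℤ → Poly n → Poly (suc n)
  mulLinear v u []       = 0ℤ ∷ []
  mulLinear v u (c ∷ cs) = v * c ∷ addConstant (u * c) (mulLinear v u cs)

  eval-mulLinear : ∀ {n} v u (f : Poly n) k → eval (mulLinear v u f) k ≡ (v + k * u) * eval f k
  eval-mulLinear v u []       k = vanish v u k
    where
    vanish : ∀ v u k → 0ℤ + k * 0ℤ ≡ (v + k * u) * 0ℤ
    vanish = solve-∀
  eval-mulLinear v u (c ∷ cs) k with mulLinear v u cs | eval-mulLinear v u cs k
  ... | d ∷ ds | ih = begin
    v * c + k * (u * c + d + k * eval ds k)  ≡⟨ cong (λ e → v * c + k * e) (ℤP.+-assoc (u * c) d _) ⟩
    v * c + k * (u * c + (d + k * eval ds k)) ≡⟨ cong (λ e → v * c + k * (u * c + e)) ih ⟩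
    v * c + k * (u * c + (v + k * u) * eval cs k) ≡⟨ expand v u k c (eval cs k) ⟩
    (v + k * u) * (c + k * eval cs k) ∎
    where
    expand : ∀ v u k c e → v * c + k * (u * c + (v + k * u) * e) ≡ (v + k * u) * (c + k * e)
    expand = solve-∀

  linearPower : ℤ → ℤ → (n : ℕ) → Poly (suc n)
  linearPower v u zero    = 1ℤ ∷ []
  linearPower v u (suc n) = mulLinear v u (linearPower v u n)

  eval-linearPower : ∀ v u n k → eval (linearPower v u n) k ≡ (v + k * u) ^ n
  eval-linearPower v u zero    k = cong (λ z → 1ℤ + z) (ℤP.*-zeroʳ k)
  eval-linearPower v u (suc n) k =
    trans (eval-mulLinear v u (linearPower v u n) k) (cong ((v + k * u) *_) (eval-linearPower v u n k))

  constant-linearPower : ∀ v u n → lookup (linearPower v u n) zero ≡ v ^ n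
  constant-linearPower v u zero    = refl
  constant-linearPower v u (suc n) with linearPower v u n | constant-linearPower v u n
  ... | c ∷ cs | c≡vⁿ = cong (v *_) c≡vⁿ

  linear-linearPower : ∀ v u n → lookup (linearPower v u (suc n)) (suc zero) ≡ + suc n * u * v ^ n
  linear-linearPower v u zero = base u
    where
    base : ∀ u → u * 1ℤ + 0ℤ ≡ 1ℤ * u * 1ℤ
    base = solve-∀
  linear-linearPower v u (suc n)
    with linearPower v u (suc n) | constant-linearPower v u (suc n) | linear-linearPower v u n
  ... | c ∷ c′ ∷ cs | c≡ | c′≡ = begin
    u * c + v * c′                              ≡⟨ cong₂ (λ x y → u * x + v * y) c≡ c′≡ ⟩
    u * (v * v ^ n) + v * (+ suc n * u * v ^ n) ≡⟨ collect u v (v ^ n) (+ suc n) ⟩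
    (1ℤ + + suc n) * u * (v * v ^ n)            ≡⟨ cong (λ m → m * u * (v * v ^ n)) (sym (ℤP.pos-+ 1 (suc n))) ⟩
    + suc (suc n) * u * (v * v ^ n)             ∎
    where
    collect : ∀ u v w m → u * (v * w) + v * (m * u * w) ≡ (1ℤ + m) * u * (v * w)
    collect = solve-∀

  -- Synthetic division by X - r: f = (X - r) · quotient r f + remainder r f.
  quotient  : ∀ {n} → ℤ → Poly (suc n) → Poly n
  remainder : ∀ {n} → ℤ → Poly (suc n) → ℤ
  quotient  r (c ∷ [])          = []
  quotient  r (c ∷ cs@(_ ∷ _))  = remainder r cs ∷ quotient r cs
  remainder r (c ∷ [])          = c
  remainder r (c ∷ cs@(_ ∷ _))  = c + r * remainder r cs

  division : ∀ {n} r (f : Poly (suc n)) k → eval f k ≡ (k - r) * eval (quotient r f) k + remainder r f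
  division r (c ∷ [])         k = base c k r
    where
    base : ∀ c k r → c + k * 0ℤ ≡ (k - r) * 0ℤ + c
    base = solve-∀
  division r (c ∷ cs@(_ ∷ _)) k = begin
    c + k * eval cs k                                          ≡⟨ cong (λ e → c + k * e) (division r cs k) ⟩
    c + k * ((k - r) * eval (quotient r cs) k + remainder r cs) ≡⟨ shift c k r (eval (quotient r cs) k) (remainder r cs) ⟩
    (k - r) * (remainder r cs + k * eval (quotient r cs) k) + (c + r * remainder r cs) ∎
    where
    shift : ∀ c k r q ρ → c + k * ((k - r) * q + ρ) ≡ (k - r) * (ρ + k * q) + (c + r * ρ)
    shift = solve-∀

  remainder-value : ∀ {n} r (f : Poly (suc n)) → eval f r ≡ remainder r f
  remainder-value r f = begin
    eval f r                                          ≡⟨ division r f r ⟩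
    (r - r) * eval (quotient r f) r + remainder r f   ≡⟨ cong (λ z → z * eval (quotient r f) r + remainder r f) (ℤP.+-inverseʳ r) ⟩
    0ℤ + remainder r f                                ≡⟨ ℤP.+-identityˡ _ ⟩
    remainder r f                                     ∎

  AllDivisible : ∀ {n} → ℤ → Poly n → Set
  AllDivisible P f = ∀ j → P ∣ℤ lookup f j

  divisible-dividend : ∀ {n} P r (f : Poly (suc n)) →
                       AllDivisible P (quotient r f) → P ∣ℤ remainder r f → AllDivisible P f
  divisible-dividend P r (c ∷ [])         _   P∣ρ zero    = P∣ρ
  divisible-dividend P r (c ∷ cs@(_ ∷ _)) P∣q P∣ρ zero    =
    subst (P ∣ℤ_) (cancel c (r * remainder r cs)) (ℤ∣.∣m∣n⇒∣m-n P∣ρ (ℤ∣.∣n⇒∣m*n r (P∣q zero)))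
    where
    cancel : ∀ c x → c + x - x ≡ c
    cancel = solve-∀
  divisible-dividend P r (c ∷ cs@(_ ∷ _)) P∣q P∣ρ (suc j) =
    divisible-dividend P r cs (P∣q ∘ suc) (P∣q zero) j

  module _ {p : ℕ} (p-prime : Prime p) where

    euclid-ℤ : ∀ a b → + p ∣ℤ a * b → ¬ + p ∣ℤ a → + p ∣ℤ b
    euclid-ℤ a b p∣ab p∤a
      with euclidsLemma Int.∣ a ∣ Int.∣ b ∣ p-prime (subst (p ∣_) (ℤP.abs-* a b) (ℤ∣.∣⇒∣ᵤ p∣ab))
    ... | inj₁ p∣a = ⊥-elim (p∤a (ℤ∣.∣ᵤ⇒∣ p∣a))
    ... | inj₂ p∣b = ℤ∣.∣ᵤ⇒∣ p∣b

    Incongruent : ∀ {n} → (Fin n → ℤ) → Set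
    Incongruent R = ∀ i j → + p ∣ℤ R i - R j → i ≡ j

    roots⇒divisible : ∀ {n} (f : Poly n) (R : Fin n → ℤ) → Incongruent R →
                      (∀ i → + p ∣ℤ eval f (R i)) → AllDivisible (+ p) f
    roots⇒divisible []      R incong roots ()
    roots⇒divisible {suc n} f R incong roots =
      divisible-dividend (+ p) r f
        (roots⇒divisible (quotient r f) (R ∘ suc) (λ i j → suc-injective ∘ incong (suc i) (suc j)) quotient-roots)
        p∣ρ
      where
      r : ℤ
      r = R zero
      p∣ρ : + p ∣ℤ remainder r f
      p∣ρ = subst (+ p ∣ℤ_) (remainder-value r f) (roots zero)
      quotient-roots : ∀ i → + p ∣ℤ eval (quotient r f) (R (suc i))
      quotient-roots i =
        euclid-ℤ (R (suc i) - r) _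
          (ℤ∣.∣m+n∣n⇒∣m (subst (+ p ∣ℤ_) (division r f (R (suc i))) (roots (suc i))) p∣ρ)
          (λ p∣Ri-r → 0≢1+n (sym (incong (suc i) zero p∣Ri-r)))

open Polynomial

multiple<⇒0 : ∀ {p k} → p ∣ k → k < p → k ≡ 0
multiple<⇒0 {k = zero}  _   _   = refl
multiple<⇒0 {k = suc k} p∣k k<p = contradiction (∣⇒≤ p∣k) (ℕP.<⇒≱ k<p)

module PowerSums where

  open Int using (_+_; _*_; _-_; _^_)
  open import Data.Integer.Tactic.RingSolver using (solve-∀)

  +-Σ : ∀ {k} (f : Fin k → ℕ) → + Σ f ≡ Σℤ (λ j → + f j)
  +-Σ {zero}  f = refl
  +-Σ {suc k} f = trans (ℤP.pos-+ (f zero) _) (cong (λ z → + f zero + z) (+-Σ (f ∘ suc)))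

  +-^ : ∀ a n → + (a Nat.^ n) ≡ (+ a) ^ n
  +-^ a zero    = refl
  +-^ a (suc n) = trans (ℤP.pos-* a (a Nat.^ n)) (cong (+ a *_) (+-^ a n))

  congruent<⇒≡ : ∀ {p a b} → a < p → b < p → + p ∣ℤ + a - + b → a ≡ b
  congruent<⇒≡ {p} {a} {b} a<p b<p p∣a-b = ℤP.+-injective (ℤP.i-j≡0⇒i≡j (+ a) (+ b) a-b≡0)
    where
    p∣∣a⊖b∣ : p ∣ Int.∣ a ⊖ b ∣
    p∣∣a⊖b∣ = subst (λ z → p ∣ Int.∣ z ∣) (ℤP.m-n≡m⊖n a b) (ℤ∣.∣⇒∣ᵤ p∣a-b)
    ∣a⊖b∣<p : Int.∣ a ⊖ b ∣ < p
    ∣a⊖b∣<p = ℕP.≤-<-trans (ℤP.∣m⊝n∣≤m⊔n a b) (ℕP.⊔-lub a<p b<p)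
    a-b≡0 : + a - + b ≡ 0ℤ
    a-b≡0 = trans (ℤP.m-n≡m⊖n a b) (ℤP.∣i∣≡0⇒i≡0 (multiple<⇒0 p∣∣a⊖b∣ ∣a⊖b∣<p))

  naturals-incongruent : ∀ {p n} (p-prime : Prime p) → n ≤ p → Incongruent p-prime (λ (i : Fin n) → + toℕ i)
  naturals-incongruent p-prime n≤p i j p∣i-j =
    toℕ-injective (congruent<⇒≡ (ℕP.<-≤-trans (toℕ<n i) n≤p) (ℕP.<-≤-trans (toℕ<n j) n≤p) p∣i-j)

  -- If Σ_j a_j (v_j + n u_j)^{t+1} is divisible by the prime p > t+1 for
  -- n = 0, …, t+1, then so is Σ_j a_j u_j v_j^t, its linear coefficient in n
  -- divided by t+1.
  linear-coefficient : ∀ {p m} → Prime p → ∀ t → suc t < p → (a v u : Fin m → ℕ) →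
                       (∀ n → n ≤ suc t → p ∣ Σ (λ j → a j Nat.* (v j Nat.+ n Nat.* u j) Nat.^ suc t)) →
                       p ∣ Σ (λ j → a j Nat.* u j Nat.* v j Nat.^ t)
  linear-coefficient {p} {m} p-prime t t+1<p a v u on-points =
    [ (λ p∣t+1 → contradiction (multiple<⇒0 p∣t+1 t+1<p) (λ ())) , id ]′
      (euclidsLemma (suc t) _ p-prime (ℤ∣.∣⇒∣ᵤ (subst (+ p ∣ℤ_) coefficient (all-divisible (suc zero)))))
    where
    A : Fin m → ℤ
    A j = + a j
    F : Fin m → Poly (suc (suc t))
    F j = linearPower (+ v j) (+ u j) (suc t)
    f : Poly (suc (suc t))
    f = combination A F

    cast-term : ∀ j n → + (a j Nat.* (v j Nat.+ n Nat.* u j) Nat.^ suc t) ≡ + a j * (+ v j + + n * + u j) ^ suc t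
    cast-term j n = begin
      + (a j Nat.* (v j Nat.+ n Nat.* u j) Nat.^ suc t)   ≡⟨ ℤP.pos-* (a j) _ ⟩
      + a j * + ((v j Nat.+ n Nat.* u j) Nat.^ suc t)   ≡⟨ cong (+ a j *_) (+-^ _ (suc t)) ⟩
      + a j * (+ (v j Nat.+ n Nat.* u j)) ^ suc t       ≡⟨ cong (λ z → + a j * z ^ suc t) (trans (ℤP.pos-+ (v j) _) (cong (λ z → + v j + z) (ℤP.pos-* n (u j)))) ⟩
      + a j * (+ v j + + n * + u j) ^ suc t       ∎

    value : ∀ n → eval f (+ n) ≡ + Σ (λ j → a j Nat.* (v j Nat.+ n Nat.* u j) Nat.^ suc t)
    value n = begin
      eval f (+ n)                                                        ≡⟨ eval-combination A F (+ n) ⟩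
      Σℤ (λ j → + a j * eval (linearPower (+ v j) (+ u j) (suc t)) (+ n)) ≡⟨ sum-cong-≗ (λ j → cong (+ a j *_) (eval-linearPower _ _ (suc t) (+ n))) ⟩
      Σℤ (λ j → + a j * (+ v j + + n * + u j) ^ suc t)                     ≡⟨ sum-cong-≗ (λ j → sym (cast-term j n)) ⟩
      Σℤ (λ j → + (a j Nat.* (v j Nat.+ n Nat.* u j) Nat.^ suc t))                ≡⟨ sym (+-Σ (λ j → a j Nat.* (v j Nat.+ n Nat.* u j) Nat.^ suc t)) ⟩
      + Σ (λ j → a j Nat.* (v j Nat.+ n Nat.* u j) Nat.^ suc t)                   ∎

    cast-linear-term : ∀ j → + a j * (+ suc t * + u j * (+ v j) ^ t) ≡ + suc t * + (a j Nat.* u j Nat.* v j Nat.^ t)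
    cast-linear-term j = begin
      + a j * (+ suc t * + u j * (+ v j) ^ t)           ≡⟨ commute (+ a j) (+ suc t) (+ u j) ((+ v j) ^ t) ⟩
      + suc t * (+ a j * + u j * (+ v j) ^ t)           ≡⟨ cong (λ z → + suc t * (+ a j * + u j * z)) (sym (+-^ (v j) t)) ⟩
      + suc t * (+ a j * + u j * + (v j Nat.^ t))       ≡⟨ cong (λ z → + suc t * (z * + (v j Nat.^ t))) (sym (ℤP.pos-* (a j) (u j))) ⟩
      + suc t * (+ (a j Nat.* u j) * + (v j Nat.^ t))     ≡⟨ cong (+ suc t *_) (sym (ℤP.pos-* (a j Nat.* u j) (v j Nat.^ t))) ⟩
      + suc t * + (a j Nat.* u j Nat.* v j Nat.^ t)         ∎
      where
      commute : ∀ a T u w → a * (T * u * w) ≡ T * (a * u * w)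
      commute = solve-∀

    coefficient : lookup f (suc zero) ≡ + (suc t Nat.* Σ (λ j → a j Nat.* u j Nat.* v j Nat.^ t))
    coefficient = begin
      lookup f (suc zero)                                            ≡⟨ coefficient-combination A F (suc zero) ⟩
      Σℤ (λ j → + a j * lookup (linearPower (+ v j) (+ u j) (suc t)) (suc zero))
        ≡⟨ sum-cong-≗ (λ j → cong (+ a j *_) (linear-linearPower (+ v j) (+ u j) t)) ⟩
      Σℤ (λ j → + a j * (+ suc t * + u j * (+ v j) ^ t))               ≡⟨ sum-cong-≗ cast-linear-term ⟩
      Σℤ (λ j → + suc t * + (a j Nat.* u j Nat.* v j Nat.^ t))             ≡⟨ sym (*-distribˡ-sum (+ suc t) (λ j → + (a j Nat.* u j Nat.* v j Nat.^ t))) ⟩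
      + suc t * Σℤ (λ j → + (a j Nat.* u j Nat.* v j Nat.^ t))             ≡⟨ cong (+ suc t *_) (sym (+-Σ (λ j → a j Nat.* u j Nat.* v j Nat.^ t))) ⟩
      + suc t * + Σ (λ j → a j Nat.* u j Nat.* v j Nat.^ t)                ≡⟨ sym (ℤP.pos-* (suc t) _) ⟩
      + (suc t Nat.* Σ (λ j → a j Nat.* u j Nat.* v j Nat.^ t))              ∎

    all-divisible : AllDivisible (+ p) f
    all-divisible = roots⇒divisible p-prime f (λ i → + toℕ i) (naturals-incongruent p-prime t+1<p)
      (λ i → subst (+ p ∣ℤ_) (sym (value (toℕ i))) (ℤ∣.∣ᵤ⇒∣ (on-points (toℕ i) (ℕP.≤-pred (toℕ<n i)))))

open PowerSums using (linear-coefficient)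

module Congruence (p : ℕ) .{{_ : NonZero p}} where

  open Nat using (_+_; _*_; _^_)

  infix 4 _≈_
  _≈_ : ℕ → ℕ → Set
  a ≈ b = a % p ≡ b % p

  +-cong : ∀ {a a′ b b′} → a ≈ a′ → b ≈ b′ → a + b ≈ a′ + b′
  +-cong {a} {a′} {b} {b′} a≈ b≈ =
    trans (%-distribˡ-+ a b p) (trans (cong₂ (λ x y → (x + y) % p) a≈ b≈) (sym (%-distribˡ-+ a′ b′ p)))

  *-cong : ∀ {a a′ b b′} → a ≈ a′ → b ≈ b′ → a * b ≈ a′ * b′
  *-cong {a} {a′} {b} {b′} a≈ b≈ =
    trans (%-distribˡ-* a b p) (trans (cong₂ (λ x y → (x * y) % p) a≈ b≈) (sym (%-distribˡ-* a′ b′ p)))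

  ^-cong : ∀ {a a′} n → a ≈ a′ → a ^ n ≈ a′ ^ n
  ^-cong zero    a≈ = refl
  ^-cong (suc n) a≈ = *-cong a≈ (^-cong n a≈)

  Σ-cong : ∀ {k} {f g : Fin k → ℕ} → (∀ j → f j ≈ g j) → Σ f ≈ Σ g
  Σ-cong {zero}  f≈g = refl
  Σ-cong {suc k} f≈g = +-cong (f≈g zero) (Σ-cong (f≈g ∘ suc))

  Σ-divisible : ∀ {k} (f : Fin k → ℕ) → (∀ j → p ∣ f j) → p ∣ Σ f
  Σ-divisible {zero}  f p∣f = p ∣0
  Σ-divisible {suc k} f p∣f = ∣m∣n⇒∣m+n (p∣f zero) (Σ-divisible (f ∘ suc) (p∣f ∘ suc))

  reduce : ℕ → Fin p
  reduce n = fromℕ< (m%n<n n p)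

  reduce≈ : ∀ n → toℕ (reduce n) ≈ n
  reduce≈ n = trans (cong (_% p) (toℕ-fromℕ< (m%n<n n p))) (m%n%n≡m%n n p)

  along : ∀ {d} → (Fin d → Fin p) → (Fin d → Fin p) → ℕ → Fin d → Fin p
  along x y n k = reduce (toℕ (x k) + n * toℕ (y k))

  Σ-linear : ∀ {k} (c x y : Fin k → ℕ) n →
             Σ (λ j → c j * (x j + n * y j)) ≡ Σ (λ j → c j * x j) + n * Σ (λ j → c j * y j)
  Σ-linear {zero}  c x y n = sym (ℕP.*-zeroʳ n)
  Σ-linear {suc k} c x y n = begin
    c zero * (x zero + n * y zero) + Σ (λ j → c (suc j) * (x (suc j) + n * y (suc j)))
      ≡⟨ cong (λ z → c zero * (x zero + n * y zero) + z) (Σ-linear (c ∘ suc) (x ∘ suc) (y ∘ suc) n) ⟩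
    c zero * (x zero + n * y zero) + (Σ (λ j → c (suc j) * x (suc j)) + n * Σ (λ j → c (suc j) * y (suc j)))
      ≡⟨ distribute (c zero) (x zero) (y zero) n _ _ ⟩
    c zero * x zero + Σ (λ j → c (suc j) * x (suc j)) + n * (c zero * y zero + Σ (λ j → c (suc j) * y (suc j))) ∎
    where
    open import Data.Nat.Tactic.RingSolver using (solve-∀)
    distribute : ∀ c x y n A B → c * (x + n * y) + (A + n * B) ≡ c * x + A + n * (c * y + B)
    distribute = solve-∀

  evalForm-along : ∀ {d} (c : LinearForm p d) x y n → evalForm c (along x y n) ≈ evalForm c x + n * evalForm c y
  evalForm-along c x y n =
    trans (Σ-cong (λ k → *-cong {toℕ (c k)} refl (reduce≈ (toℕ (x k) + n * toℕ (y k)))))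
          (cong (_% p) (Σ-linear (toℕ ∘ c) (toℕ ∘ x) (toℕ ∘ y) n))

module _ {p : ℕ} .{{_ : NonZero p}} (p-prime : Prime p) where

  open Nat using (_+_; _*_; _^_)
  open Congruence p

  Nondegenerate : ∀ {d} → LinearForm p d → Set
  Nondegenerate c = ¬ (∀ y → p ∣ evalForm c y)

  annihilator⇒0 : ∀ {d} (c : LinearForm p d) → Nondegenerate c → (a : Fin p) →
                  (∀ y → p ∣ toℕ a * evalForm c y) → toℕ a ≡ 0
  annihilator⇒0 c nondeg a annihilates with p ∣? toℕ a
  ... | yes p∣a = multiple<⇒0 p∣a (toℕ<n a)
  ... | no  p∤a = ⊥-elim (nondeg λ y → [ ⊥-elim ∘ p∤a , id ]′ (euclidsLemma _ _ p-prime (annihilates y)))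

  zeroₚ oneₚ : Fin p
  zeroₚ = fromℕ< (>-nonZero⁻¹ p)
  oneₚ  = fromℕ< (nonTrivial⇒n>1 p {{prime⇒nonTrivial p-prime}})

  basis : ∀ {m} → Fin m → Fin m → Fin p
  basis i j with j ≟ i
  ... | yes _ = oneₚ
  ... | no  _ = zeroₚ

  basis-diagonal : ∀ {m} (i : Fin m) → toℕ (basis i i) ≡ 1
  basis-diagonal i with i ≟ i
  ... | yes _   = toℕ-fromℕ< _
  ... | no  i≢i = ⊥-elim (i≢i refl)

  -- In positive degree, an independent system contains no identically vanishing
  -- form: the basis vector at such a form would be a nontrivial relation.
  independent⇒nondegenerate : ∀ {d m s} (L : Fin m → LinearForm p d) → 1 ≤ s →
                              DegreeIndependent p d m s L → ∀ i → Nondegenerate (L i)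
  independent⇒nondegenerate {s = suc s′} L _ independent i degenerate =
    contradiction (trans (sym (basis-diagonal i)) (independent (basis i) relation i)) (λ ())
    where
    term : ∀ x j → p ∣ toℕ (basis i j) * evalForm (L j) x ^ suc s′
    term x j with j ≟ i
    ... | yes refl = ∣n⇒∣m*n (toℕ oneₚ) (∣m⇒∣m*n (evalForm (L i) x ^ s′) (degenerate x))
    ... | no  _ rewrite toℕ-fromℕ< (>-nonZero⁻¹ p) = p ∣0
    relation : ∀ x → Σ (λ j → toℕ (basis i j) * evalForm (L j) x ^ suc s′) % p ≡ 0
    relation x = n∣m⇒m%n≡0 _ p (Σ-divisible _ (term x))

  step : ∀ {d m t} (L : Fin m → LinearForm p d) → (∀ i → Nondegenerate (L i)) → suc t < p →
         DegreeIndependent p d m t L → DegreeIndependent p d m (suc t) L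
  step {d} {m} {t} L nondegenerate t+1<p independent a vanishes i =
    annihilator⇒0 (L i) (nondegenerate i) (a i) weighted
    where
    E : Fin m → (Fin d → Fin p) → ℕ
    E j = evalForm (L j)

    on-line : ∀ x y n → p ∣ Σ (λ j → toℕ (a j) * (E j x + n * E j y) ^ suc t)
    on-line x y n = m%n≡0⇒n∣m _ p
      (trans (Σ-cong (λ j → *-cong {toℕ (a j)} refl (^-cong (suc t) (sym (evalForm-along (L j) x y n)))))
             (vanishes (along x y n)))

    -- Its linear coefficient in n: a degree-t relation with coefficients a_j L_j(y).
    polarized : ∀ x y → p ∣ Σ (λ j → toℕ (a j) * E j y * E j x ^ t)
    polarized x y = linear-coefficient p-prime t t+1<p (toℕ ∘ a) (λ j → E j x) (λ j → E j y) (λ n _ → on-line x y n)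

    weighted : ∀ y → p ∣ toℕ (a i) * E i y
    weighted y = m%n≡0⇒n∣m _ p (trans (sym (toℕ-fromℕ< (m%n<n (toℕ (a i) * E i y) p))) (independent b relation i))
      where
      b : Fin m → Fin p
      b j = reduce (toℕ (a j) * E j y)
      relation : ∀ x → Σ (λ j → toℕ (b j) * E j x ^ t) % p ≡ 0
      relation x = trans (Σ-cong (λ j → *-cong (reduce≈ (toℕ (a j) * E j y)) refl)) (n∣m⇒m%n≡0 _ p (polarized x y))

  propagate : ∀ {d m s} (L : Fin m → LinearForm p d) → 1 ≤ s → DegreeIndependent p d m s L →
              ∀ t → s ≤ t → t < p → DegreeIndependent p d m t L
  propagate L 1≤s independent t s≤t t<p with ℕP.m≤n⇒m<n∨m≡n s≤t
  ... | inj₂ refl = independent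
  propagate L 1≤s independent zero    _ _     | inj₁ ()
  propagate L 1≤s independent (suc t) _ t+1<p | inj₁ (s≤s s≤t) =
    step L (independent⇒nondegenerate L 1≤s independent) t+1<p
      (propagate L 1≤s independent t s≤t (ℕP.<-trans (ℕP.n<1+n t) t+1<p))

lemma5p2 : (p : ℕ) .{{_ : NonZero p}} → Prime p → (s : ℕ) → 1 ≤ s →
           (d m : ℕ) (L : Fin m → LinearForm p d) →
           DegreeIndependent p d m s L →
           (t : ℕ) → s ≤ t → t < p → DegreeIndependent p d m t L
lemma5p2 p p-prime s 1≤s d m L = propagate p-prime L 1≤s
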